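{- Let $\mathcal{C}=\{c_1,\ldots,c_m\}$ be a collection of cliques (vertex sets) with graph union $U$ on vertex set $V=c_1\cup\cdots\cup c_m$, and let $\Gamma_J$, $\gamma_J$ and signatures $f_H$ be as in the context. Let $\mathcal{I}_m$ be the set of all nonempty intersecting families $\mathcal{F}\subseteq\mathcal{P}(\{1,\ldots,m\})$. Define, in indeterminates $\mathbf{x}=(x_J : J\subseteq\{1,\ldots,m\})$, \[ \Phi(\mathbf{x})=\sum_{\mathcal{F}\in\mathcal{I}_m}\ \prod_{J\in\mathcal{F}}\left[(1+x_J)^{\gamma_J}-1\right]. \] Then $\Phi$ is the generating function for clique counts of $U$ by signature: for every function $\alpha:\mathcal{P}(\{1,\ldots,m\})\to\mathbb{N}_0$, the coefficient of $\prod_J x_J^{\alpha(J)}$ in $\Phi(\mathbf{x})$ equals the number of nonempty sets $H\subseteq V$ that induce a clique (complete subgraph) in $U$ and have signature $f_H=\alpha$.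
   Context: A clique is identified with its vertex set. For a collection $\mathcal{C}=\{c_1,\ldots,c_m\}$ of cliques of a graph, the graph union $U$ has vertex set $V=\bigcup_{j=1}^m c_j$, and distinct $u,v\in V$ are adjacent iff $u,v\in c_j$ for some $j$. For $J\subseteq\{1,\ldots,m\}$ let $\Gamma_J=\left(\bigcap_{j\in J}c_j\right)\setminus\left(\bigcup_{j\notin J}c_j\right)$ (with the empty intersection taken to be $V$), i.e. $\Gamma_J$ is the set of $v\in V$ with $\{j: v\in c_j\}=J$; let $\gamma_J=|\Gamma_J|$. For $H\subseteq V$, its signature is the function $f_H:\mathcal{P}(\{1,\ldots,m\})\to\mathbb{N}_0$, $f_H(J)=|H\cap\Gamma_J|$. A family $\mathcal{F}$ of subsets of $\{1,\ldots,m\}$ is intersecting if $A\cap B\neq\emptyset$ for all $A,B\in\mathcal{F}$. -}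

module Defs where

open import Data.Bool using (Bool; true; false; _∧_; if_then_else_)
open import Data.Nat using (ℕ; zero; suc; _∸_; _≡ᵇ_)
open import Data.Integer using (ℤ; +_) renaming (_+_ to _+ℤ_; _*_ to _*ℤ_; _-_ to _-ℤ_)
open import Data.Fin using (Fin)
open import Data.Fin.Subset using (Subset; inside; outside; _∈_; _⊆_; _∩_; ⋃; ∣_∣; Nonempty)
open import Data.Fin.Subset.Properties using (_∈?_; _⊆?_; nonempty?)
open import Data.Fin.Properties using (all?; any?) renaming (_≟_ to _≟F_)
open import Data.Vec using (Vec; []; _∷_)
import Data.Vec as Vec
open import Data.Vec.Properties using (≡-dec)
import Data.Bool.Properties as BoolP
open import Data.List using (List; []; _∷_; _++_; map; concatMap; foldr; filter; length; upTo)
import Data.List as List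
open import Data.List.Relation.Unary.All using (All)
import Data.List.Relation.Unary.All as All
open import Data.Product using (Σ; ∃; _×_; _,_)
open import Relation.Binary.PropositionalEquality using (_≡_; _≢_)
open import Relation.Nullary using (Dec; yes; no; ¬_; does)
open import Relation.Nullary.Decidable using (_×-dec_; _→-dec_; ¬?; map′)
open import Relation.Unary using (Decidable)

allSubsets : (n : ℕ) → List (Subset n)
allSubsets zero    = [] ∷ []
allSubsets (suc n) = map (outside ∷_) (allSubsets n) ++ map (inside ∷_) (allSubsets n)

-- all sublists of a list (each subfamily of a duplicate-free list exactly once)
sublists : {A : Set} → List A → List (List A)
sublists []       = [] ∷ []
sublists (x ∷ xs) = sublists xs ++ map (x ∷_) (sublists xs)

_≟S_ : {m : ℕ} → (J K : Subset m) → Dec (J ≡ K)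
_≟S_ = ≡-dec BoolP._≟_

allSubset? : {m : ℕ} {P : Subset m → Set} → Decidable P → Dec (∀ J → P J)
allSubset? {zero}  P? with P? []
... | yes p = yes λ { [] → p }
... | no ¬p = no λ h → ¬p (h [])
allSubset? {suc m} P? with allSubset? (λ J → P? (outside ∷ J)) | allSubset? (λ J → P? (inside ∷ J))
... | yes p | yes q = yes λ { (false ∷ J) → p J ; (true ∷ J) → q J }
... | no ¬p | _     = no λ h → ¬p (λ J → h (outside ∷ J))
... | yes _ | no ¬q = no λ h → ¬q (λ J → h (inside ∷ J))

-- A monomial ∏_J x_J^(α J) is its exponent function α; a series is its
-- coefficient function.

Mon : ℕ → Set
Mon m = Subset m → ℕ

Poly : ℕ → Set
Poly m = Mon m → ℤ

coeff : {m : ℕ} → Poly m → Mon m → ℤ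
coeff p α = p α

below : {m : ℕ} → Mon m → List (Mon m)
below {zero}  α = map (λ k → λ { [] → k }) (upTo (suc (α [])))
below {suc m} α =
  concatMap (λ b₀ → map (λ b₁ → λ { (false ∷ J) → b₀ J ; (true ∷ J) → b₁ J })
                        (below (λ J → α (inside ∷ J))))
            (below (λ J → α (outside ∷ J)))

sumℤ : List ℤ → ℤ
sumℤ = foldr _+ℤ_ (+ 0)

isZeroMon : {m : ℕ} → Mon m → Bool
isZeroMon {zero}  α = α [] ≡ᵇ 0
isZeroMon {suc m} α = isZeroMon (λ J → α (outside ∷ J)) ∧ isZeroMon (λ J → α (inside ∷ J))

oneP : {m : ℕ} → Poly m
oneP α = if isZeroMon α then + 1 else + 0

var : {m : ℕ} → Subset m → Poly m
var J α = if isZeroMon (λ K → if does (K ≟S J) then α K ∸ 1 else α K)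
             ∧ (α J ≡ᵇ 1)
          then + 1 else + 0

_+P_ : {m : ℕ} → Poly m → Poly m → Poly m
(p +P q) α = p α +ℤ q α

_-P_ : {m : ℕ} → Poly m → Poly m → Poly m
(p -P q) α = p α -ℤ q α

_*P_ : {m : ℕ} → Poly m → Poly m → Poly m
(p *P q) α = sumℤ (map (λ β → p β *ℤ q (λ J → α J ∸ β J)) (below α))

_^P_ : {m : ℕ} → Poly m → ℕ → Poly m
p ^P zero  = oneP
p ^P suc k = p *P (p ^P k)

prodP : {m : ℕ} {A : Set} → (A → Poly m) → List A → Poly m
prodP f = foldr (λ a acc → f a *P acc) oneP

sumP : {m : ℕ} {A : Set} → (A → Poly m) → List A → Poly m
sumP f = foldr (λ a acc → f a +P acc) (λ _ → + 0)

module Cliques {n m : ℕ} (c : Fin m → Subset n) where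

  V : Subset n
  V = ⋃ (List.tabulate c)

  memb : Fin n → Subset m
  memb v = Vec.tabulate (λ j → does (v ∈? c j))

  Γ : Subset m → Subset n
  Γ J = Vec.tabulate (λ v → does (v ∈? V) ∧ does (memb v ≟S J))

  γ : Subset m → ℕ
  γ J = ∣ Γ J ∣

  Adj : Fin n → Fin n → Set
  Adj u v = ∃ λ j → u ∈ c j × v ∈ c j

  IsCliqueU : Subset n → Set
  IsCliqueU H = ∀ u v → u ∈ H → v ∈ H → u ≢ v → Adj u v

  sig : Subset n → Mon m
  sig H J = ∣ H ∩ Γ J ∣

  Counted : Mon m → Subset n → Set
  Counted α H = Nonempty H × H ⊆ V × IsCliqueU H × (∀ J → sig H J ≡ α J)

  Counted? : (α : Mon m) → Decidable (Counted α)
  Counted? α H =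
    nonempty? H ×-dec (H ⊆? V) ×-dec clique? ×-dec allSubset? (λ J → sig H J Data.Nat.≟ α J)
    where
    clique? : Dec (IsCliqueU H)
    clique? = all? λ u → all? λ v →
      (u ∈? H) →-dec ((v ∈? H) →-dec (¬? (u ≟F v) →-dec
        any? (λ j → (u ∈? c j) ×-dec (v ∈? c j))))

  cliqueCount : Mon m → ℕ
  cliqueCount α = length (filter (Counted? α) (allSubsets n))

  Intersecting : List (Subset m) → Set
  Intersecting F = All (λ A → All (λ B → Nonempty (A ∩ B)) F) F

  NonemptyFam : List (Subset m) → Set
  NonemptyFam F = ¬ (F ≡ [])

  NonemptyIntersecting? : Decidable (λ F → NonemptyFam F × Intersecting F)
  NonemptyIntersecting? F = ne? F ×-dec All.all? (λ A → All.all? (λ B → nonempty? (A ∩ B)) F) F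
    where
    ne? : (F : List (Subset m)) → Dec (NonemptyFam F)
    ne? []      = no λ h → h Relation.Binary.PropositionalEquality.refl
    ne? (_ ∷ _) = yes λ ()

  ℐ : List (List (Subset m))
  ℐ = filter NonemptyIntersecting? (sublists (allSubsets m))

  Φ : Poly m
  Φ = sumP (λ F → prodP (λ J → ((oneP +P var J) ^P γ J) -P oneP) F) ℐ

-- Only one family contributes to the coefficient of x^α in Φ, namely the support
-- T = {J : α J > 0} of α: a family containing some J with α J = 0 contributes the constant
-- term of (1 + x_J)^γ_J − 1, which is 0, and a family missing some J with α J > 0 cannot
-- produce x_J. Since the factors involve distinct variables, the coefficient is therefore
-- [T nonempty and intersecting] · ∏_J C(γ_J, α_J).
-- On the other side, a set H ⊆ V of signature α is a choice of α J vertices in every Γ_J, so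
-- there are ∏_J C(γ_J, α_J) of them, and the classes met by H are exactly T. Two vertices are
-- adjacent iff their sets of cliques meet, so H is a nonempty clique iff T is a nonempty
-- intersecting family.

module Submission where

open import Defs
open import Data.Bool using (Bool; true; false; _∧_; if_then_else_; T)
open import Data.Bool.Properties using (∧-conicalˡ; ∧-conicalʳ; ∧-zeroʳ)
open import Data.Unit using (tt)
open import Data.Empty using (⊥-elim)
open import Data.Fin using (Fin) renaming (zero to fzero; suc to fsuc; _≟_ to _≟ᶠ_)
open import Data.Fin.Subset
  using (Subset; inside; outside; _⊆_; _∩_; ∣_∣; Nonempty; ⋃) renaming (_∈_ to _∈ˢ_)
open import Data.Fin.Subset.Properties
  using (_⊆?_; drop-∷-⊆; out⊆; in⊆in; ∉⊥; x∈p∪q⁻; x∈p∩q⁺; x∈p∩q⁻; ∣p∣≤∣x∷p∣) renaming (_∈?_ to _∈ˢ?_)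
open import Data.Integer using (ℤ; +_) renaming (_+_ to _+ℤ_; _*_ to _*ℤ_; _-_ to _-ℤ_)
import Data.Integer.Properties as ℤ
open import Algebra.Properties.CommutativeSemigroup ℤ.+-commutativeSemigroup
  using () renaming (interchange to +ℤ-interchange)
open import Data.List
  using (List; []; _∷_; [_]; _++_; map; filter; length; concatMap; applyUpTo; foldr; tabulate)
open import Data.List.Membership.Propositional using (_∈_; _∉_)
open import Data.List.Membership.Propositional.Properties
  using (∈-map⁺; ∈-map⁻; ∈-++⁺ˡ; ∈-++⁺ʳ; ∈-filter⁺; ∈-filter⁻)
import Data.List.Properties as List
open import Data.List.Relation.Binary.Sublist.Propositional using ([]; _∷_; _∷ʳ_) renaming (_⊆_ to _⊑_)
open import Data.List.Relation.Binary.Sublist.Propositional.Properties using (All-resp-⊆; Any-resp-⊆)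
open import Data.List.Relation.Unary.All using ([])
import Data.List.Relation.Unary.All as All
open import Data.List.Relation.Unary.Any using (here; there; any?)
open import Data.List.Relation.Binary.Disjoint.Propositional using (Disjoint)
open import Data.List.Relation.Unary.Unique.Propositional using (Unique; []; _∷_)
import Data.List.Relation.Unary.Unique.Propositional.Properties as Unique
open import Data.Nat using (ℕ; zero; suc; _+_; _*_; _∸_; _≤_; _<_; z≤n; s≤s; _≤?_)
import Data.Nat.Properties as ℕ
open import Data.Nat.Combinatorics using (_C_; nCk+nC[k+1]≡[n+1]C[k+1])
open import Data.Nat.ListAction using (sum; product)
open import Data.Nat.ListAction.Properties using (sum-++)
open import Data.Product using (∃; _×_; _,_; proj₁; proj₂)
import Data.Product
open import Data.Sum using (_⊎_; inj₁; inj₂)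
open import Data.Vec using ([]; _∷_; here; there)
import Data.Vec as Vec
import Data.Vec.Properties as Vec
open import Function using (_∘_; id; case_of_)
open import Relation.Binary.PropositionalEquality hiding ([_])
open import Relation.Nullary using (Dec; yes; no; ¬_; does)
open import Relation.Nullary.Decidable using (_×-dec_; _→-dec_; ¬?; dec-true; dec-false)
open import Level using (Level)

private
  variable
    a p q : Level
    A : Set a
    P : Set p
    Q : Set q

𝟙 : Dec P → ℕ
𝟙 d = if does d then 1 else 0

onlyIf : Dec P → ℤ → ℤ
onlyIf d v = if does d then v else + 0

does-⇔ : (P → Q) → (Q → P) → (d : Dec P) (e : Dec Q) → does d ≡ does e
does-⇔ P→Q Q→P (yes p) e = sym (dec-true e (P→Q p))
does-⇔ P→Q Q→P (no ¬p) e = sym (dec-false e (¬p ∘ Q→P))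

𝟙-⇔ : (P → Q) → (Q → P) → (d : Dec P) (e : Dec Q) → 𝟙 d ≡ 𝟙 e
𝟙-⇔ P→Q Q→P d e = cong (λ b → if b then 1 else 0) (does-⇔ P→Q Q→P d e)

𝟙-no : (d : Dec P) → ¬ P → 𝟙 d ≡ 0
𝟙-no d ¬p rewrite dec-false d ¬p = refl

onlyIf-cong : (d : Dec P) (e : Dec Q) → does d ≡ does e → ∀ {v w} → v ≡ w → onlyIf d v ≡ onlyIf e w
onlyIf-cong d e d≡e v≡w = cong₂ (λ b v → if b then v else + 0) d≡e v≡w

does-true⁻ : (d : Dec P) → does d ≡ true → P
does-true⁻ (yes p) _ = p

𝟙-× : (d : Dec P) (e : Dec Q) → 𝟙 (d ×-dec e) ≡ 𝟙 d * 𝟙 e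
𝟙-× (yes _) (yes _) = refl
𝟙-× (yes _) (no _)  = refl
𝟙-× (no _)  _       = refl

onlyIf-yes : (d : Dec P) {v : ℤ} → P → onlyIf d v ≡ v
onlyIf-yes d p rewrite dec-true d p = refl

onlyIf-no : (d : Dec P) {v : ℤ} → ¬ P → onlyIf d v ≡ + 0
onlyIf-no d ¬p rewrite dec-false d ¬p = refl

onlyIf-0 : (d : Dec P) → onlyIf d (+ 0) ≡ + 0
onlyIf-0 (yes _) = refl
onlyIf-0 (no _)  = refl

onlyIf-∙ : (d : Dec P) (_∙_ : ℤ → ℤ → ℤ) → (+ 0) ∙ (+ 0) ≡ + 0 →
           ∀ v w → onlyIf d v ∙ onlyIf d w ≡ onlyIf d (v ∙ w)
onlyIf-∙ (yes _) _∙_ _   v w = refl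
onlyIf-∙ (no _)  _∙_ 0∙0 v w = 0∙0

onlyIf-*ˡ : (d : Dec P) (e : Dec Q) → does d ≡ does e →
            ∀ v w → v *ℤ onlyIf d w ≡ onlyIf e (v *ℤ w)
onlyIf-*ˡ (yes _) (yes _) _  v w = refl
onlyIf-*ˡ (no _)  (no _)  _  v w = ℤ.*-zeroʳ v

onlyIf-pos : (d : Dec P) (n : ℕ) → onlyIf d (+ n) ≡ + (𝟙 d * n)
onlyIf-pos (yes _) n = cong +_ (sym (ℕ.+-identityʳ n))
onlyIf-pos (no _)  n = refl

length-filter : {P : A → Set p} (P? : ∀ x → Dec (P x)) (xs : List A) →
                length (filter P? xs) ≡ sum (map (𝟙 ∘ P?) xs)
length-filter P? []       = refl
length-filter P? (x ∷ xs) with P? x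
... | yes _ = cong suc (length-filter P? xs)
... | no  _ = length-filter P? xs

∈-allSubsets : ∀ {m} (J : Subset m) → J ∈ allSubsets m
∈-allSubsets []          = here refl
∈-allSubsets (false ∷ J) = ∈-++⁺ˡ (∈-map⁺ (outside ∷_) (∈-allSubsets J))
∈-allSubsets (true ∷ J)  = ∈-++⁺ʳ _ (∈-map⁺ (inside ∷_) (∈-allSubsets J))

allSubsets-unique : ∀ m → Unique (allSubsets m)
allSubsets-unique zero    = [] ∷ []
allSubsets-unique (suc m) =
  Unique.++⁺ (Unique.map⁺ Vec.∷-injectiveʳ u) (Unique.map⁺ Vec.∷-injectiveʳ u) outside-inside-disjoint
  where
  u = allSubsets-unique m
  outside-inside-disjoint : Disjoint (map (outside ∷_) (allSubsets m)) (map (inside ∷_) (allSubsets m))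
  outside-inside-disjoint (∈outside , ∈inside)
    with ∈-map⁻ (outside ∷_) ∈outside | ∈-map⁻ (inside ∷_) ∈inside
  ... | _ , _ , refl | _ , _ , ()

Unique-resp-⊑ : {xs ys : List A} → xs ⊑ ys → Unique ys → Unique xs
Unique-resp-⊑ []         []         = []
Unique-resp-⊑ (_ ∷ʳ s)   (_ ∷ u)    = Unique-resp-⊑ s u
Unique-resp-⊑ (refl ∷ s) (x≢ ∷ u)   = All-resp-⊆ s x≢ ∷ Unique-resp-⊑ s u

sumℤ-++ : (xs ys : List ℤ) → sumℤ (xs ++ ys) ≡ sumℤ xs +ℤ sumℤ ys
sumℤ-++ []       ys = sym (ℤ.+-identityˡ _)
sumℤ-++ (x ∷ xs) ys = trans (cong (x +ℤ_) (sumℤ-++ xs ys)) (sym (ℤ.+-assoc x _ _))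

sumℤ-map-++ : (f : A → ℤ) (xs ys : List A) →
              sumℤ (map f (xs ++ ys)) ≡ sumℤ (map f xs) +ℤ sumℤ (map f ys)
sumℤ-map-++ f xs ys = trans (cong sumℤ (List.map-++ f xs ys)) (sumℤ-++ (map f xs) (map f ys))

sumℤ-map-cong : {f g : A → ℤ} → (∀ x → f x ≡ g x) → (xs : List A) → sumℤ (map f xs) ≡ sumℤ (map g xs)
sumℤ-map-cong f≗g xs = cong sumℤ (List.map-cong f≗g xs)

sumℤ-map-+ : (f g : A → ℤ) (xs : List A) →
             sumℤ (map (λ x → f x +ℤ g x) xs) ≡ sumℤ (map f xs) +ℤ sumℤ (map g xs)
sumℤ-map-+ f g []       = refl
sumℤ-map-+ f g (x ∷ xs) = trans (cong (f x +ℤ g x +ℤ_) (sumℤ-map-+ f g xs))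
                                (+ℤ-interchange (f x) (g x) _ _)

sumℤ-concatMap : {B D : Set} (f : A → ℤ) (g : B → D → A) (ys : List D) (xs : List B) →
                 sumℤ (map f (concatMap (λ x → map (g x) ys) xs))
                   ≡ sumℤ (map (λ x → sumℤ (map (f ∘ g x) ys)) xs)
sumℤ-concatMap f g ys []       = refl
sumℤ-concatMap f g ys (x ∷ xs) = begin
  sumℤ (map f (map (g x) ys ++ concatMap _ xs))
    ≡⟨ sumℤ-map-++ f (map (g x) ys) _ ⟩
  sumℤ (map f (map (g x) ys)) +ℤ sumℤ (map f (concatMap _ xs))
    ≡⟨ cong₂ _+ℤ_ (cong sumℤ (sym (List.map-∘ ys))) (sumℤ-concatMap f g ys xs) ⟩
  sumℤ (map (f ∘ g x) ys) +ℤ _ ∎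
  where open ≡-Reasoning

sumℤ-filter : {P : A → Set p} (P? : ∀ x → Dec (P x)) (h : A → ℤ) (xs : List A) →
              sumℤ (map h (filter P? xs)) ≡ sumℤ (map (λ x → onlyIf (P? x) (h x)) xs)
sumℤ-filter P? h []       = refl
sumℤ-filter P? h (x ∷ xs) with P? x
... | yes _ = cong (h x +ℤ_) (sumℤ-filter P? h xs)
... | no  _ = trans (sumℤ-filter P? h xs) (sym (ℤ.+-identityˡ _))

sumP-apply : ∀ {m} (h : A → Poly m) (xs : List A) (α : Mon m) →
             sumP h xs α ≡ sumℤ (map (λ x → h x α) xs)
sumP-apply h []       α = refl
sumP-apply h (x ∷ xs) α = cong (h x α +ℤ_) (sumP-apply h xs α)

productℤ : List ℤ → ℤ
productℤ = foldr _*ℤ_ (+ 1)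

productℤ-zero : (f : A → ℤ) {x : A} {xs : List A} → x ∈ xs → f x ≡ + 0 → productℤ (map f xs) ≡ + 0
productℤ-zero f {xs = y ∷ ys} (here refl) fx≡0 =
  trans (cong (_*ℤ productℤ (map f ys)) fx≡0) (ℤ.*-zeroˡ (productℤ (map f ys)))
productℤ-zero f {xs = y ∷ ys} (there x∈) fx≡0 =
  trans (cong (f y *ℤ_) (productℤ-zero f x∈ fx≡0)) (ℤ.*-zeroʳ (f y))

sumℤ-sublists-∷ : (H : List A → ℤ) (x : A) (xs : List A) →
                  sumℤ (map H (sublists (x ∷ xs)))
                    ≡ sumℤ (map H (sublists xs)) +ℤ sumℤ (map (H ∘ (x ∷_)) (sublists xs))
sumℤ-sublists-∷ H x xs =
  trans (sumℤ-map-++ H (sublists xs) _)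
        (cong (sumℤ (map H (sublists xs)) +ℤ_) (cong sumℤ (sym (List.map-∘ (sublists xs)))))

sumℤ-sublists-zero : (xs : List A) (H : List A → ℤ) →
                     (∀ F → F ⊑ xs → H F ≡ + 0) → sumℤ (map H (sublists xs)) ≡ + 0
sumℤ-sublists-zero []       H H≡0 = cong (_+ℤ + 0) (H≡0 [] [])
sumℤ-sublists-zero (x ∷ xs) H H≡0 = trans (sumℤ-sublists-∷ H x xs) (cong₂ _+ℤ_
  (sumℤ-sublists-zero xs H (λ F F⊑ → H≡0 F (x ∷ʳ F⊑)))
  (sumℤ-sublists-zero xs (H ∘ (x ∷_)) (λ F F⊑ → H≡0 (x ∷ F) (refl ∷ F⊑))))

Disagrees : (P : A → Set p) → List A → A → Set _
Disagrees P F K = (K ∈ F × ¬ P K) ⊎ (K ∉ F × P K)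

sumℤ-sublists-filter : {P : A → Set p} (P? : ∀ x → Dec (P x)) {xs : List A} → Unique xs →
                       (H : List A → ℤ) →
                       (∀ F → F ⊑ xs → ∀ K → K ∈ xs → Disagrees P F K → H F ≡ + 0) →
                       sumℤ (map H (sublists xs)) ≡ H (filter P? xs)
sumℤ-sublists-filter P? {[]}     _ H _ = ℤ.+-identityʳ _
sumℤ-sublists-filter {P = P} P? {x ∷ xs} u@(_ ∷ uxs) H H≡0 =
  trans (sumℤ-sublists-∷ H x xs) (by-cases (P? x))
  where
  open ≡-Reasoning
  x∉xs = Unique.Unique[x∷xs]⇒x∉xs u
  by-cases : Dec (P x) →
             sumℤ (map H (sublists xs)) +ℤ sumℤ (map (H ∘ (x ∷_)) (sublists xs)) ≡ H (filter P? (x ∷ xs))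
  by-cases (yes px) = begin
    sumℤ (map H (sublists xs)) +ℤ sumℤ (map (H ∘ (x ∷_)) (sublists xs))
      ≡⟨ cong₂ _+ℤ_ (sumℤ-sublists-zero xs H without-x≡0)
                    (sumℤ-sublists-filter P? uxs (H ∘ (x ∷_)) with-x≡0) ⟩
    + 0 +ℤ H (x ∷ filter P? xs)
      ≡⟨ ℤ.+-identityˡ _ ⟩
    H (x ∷ filter P? xs)
      ≡⟨ cong H (List.filter-accept P? px) ⟨
    H (filter P? (x ∷ xs)) ∎
    where
    without-x≡0 : ∀ F → F ⊑ xs → H F ≡ + 0
    without-x≡0 F F⊑ = H≡0 F (x ∷ʳ F⊑) x (here refl) (inj₂ (x∉xs ∘ Any-resp-⊆ F⊑ , px))
    with-x≡0 : ∀ F → F ⊑ xs → ∀ K → K ∈ xs → Disagrees P F K → H (x ∷ F) ≡ + 0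
    with-x≡0 F F⊑ K K∈ (inj₁ (K∈F , ¬pK)) =
      H≡0 (x ∷ F) (refl ∷ F⊑) K (there K∈) (inj₁ (there K∈F , ¬pK))
    with-x≡0 F F⊑ K K∈ (inj₂ (K∉F , pK))  =
      H≡0 (x ∷ F) (refl ∷ F⊑) K (there K∈) (inj₂ (K∉x∷F , pK))
      where
      K∉x∷F : K ∉ x ∷ F
      K∉x∷F (here refl) = x∉xs K∈
      K∉x∷F (there K∈F) = K∉F K∈F
  by-cases (no ¬px) = begin
    sumℤ (map H (sublists xs)) +ℤ sumℤ (map (H ∘ (x ∷_)) (sublists xs))
      ≡⟨ cong₂ _+ℤ_ (sumℤ-sublists-filter P? uxs H (λ F F⊑ K K∈ → H≡0 F (x ∷ʳ F⊑) K (there K∈)))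
                    (sumℤ-sublists-zero xs (H ∘ (x ∷_)) with-x≡0) ⟩
    H (filter P? xs) +ℤ + 0
      ≡⟨ ℤ.+-identityʳ _ ⟩
    H (filter P? xs)
      ≡⟨ cong H (List.filter-reject P? ¬px) ⟨
    H (filter P? (x ∷ xs)) ∎
    where
    with-x≡0 : ∀ F → F ⊑ xs → H (x ∷ F) ≡ + 0
    with-x≡0 F F⊑ = H≡0 (x ∷ F) (refl ∷ F⊑) x (here refl) (inj₁ (here refl , ¬px))

1≰⇒≡0 : ∀ {n} → ¬ 1 ≤ n → n ≡ 0
1≰⇒≡0 = ℕ.n<1⇒n≡0 ∘ ℕ.≰⇒>

sum-map-*ˡ : (c : ℕ) (f : A → ℕ) (xs : List A) → sum (map (λ x → c * f x) xs) ≡ c * sum (map f xs)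
sum-map-*ˡ c f []       = sym (ℕ.*-zeroʳ c)
sum-map-*ˡ c f (x ∷ xs) =
  trans (cong (_+_ (c * f x)) (sum-map-*ˡ c f xs)) (sym (ℕ.*-distribˡ-+ c (f x) _))

sum-map-0 : {f : A → ℕ} → (∀ x → f x ≡ 0) → (xs : List A) → sum (map f xs) ≡ 0
sum-map-0 f≡0 []       = refl
sum-map-0 f≡0 (x ∷ xs) = cong₂ _+_ (f≡0 x) (sum-map-0 f≡0 xs)

product-map-1 : {f : A → ℕ} → (∀ x → f x ≡ 1) → (xs : List A) → product (map f xs) ≡ 1
product-map-1 f≡1 []       = refl
product-map-1 f≡1 (x ∷ xs) = cong₂ _*_ (f≡1 x) (product-map-1 f≡1 xs)

product-0C : (α : A → ℕ) (xs : List A) →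
             product (map (λ x → 0 C α x) xs) ≡ 0 ⊎ (∀ {x} → x ∈ xs → α x ≡ 0)
product-0C α []       = inj₂ λ ()
product-0C α (x ∷ xs) with α x in αx≡ | product-0C α xs
... | suc _ | _           = inj₁ refl
... | zero  | inj₁ rest≡0 = inj₁ (trans (ℕ.+-identityʳ _) rest≡0)
... | zero  | inj₂ rest≡0 = inj₂ λ { (here refl) → αx≡ ; (there x∈) → rest≡0 x∈ }

product-cong-off : {f g : A → ℕ} {x₀ : A} {xs : List A} → x₀ ∉ xs → (∀ x → x ≢ x₀ → f x ≡ g x) →
                   product (map f xs) ≡ product (map g xs)
product-cong-off x₀∉ f≡g =
  cong product (List.map-cong-local (All.tabulate λ {x} x∈ → f≡g x λ { refl → x₀∉ x∈ }))

product-+-at : {f g h : A → ℕ} {x₀ : A} {xs : List A} → Unique xs → x₀ ∈ xs →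
               (∀ x → x ≢ x₀ → f x ≡ h x) → (∀ x → x ≢ x₀ → g x ≡ h x) → f x₀ + g x₀ ≡ h x₀ →
               product (map f xs) + product (map g xs) ≡ product (map h xs)
product-+-at {f = f} {g} {h} {x₀} {_ ∷ xs} u (here refl) f≡h g≡h at-x₀ = begin
  f x₀ * product (map f xs) + g x₀ * product (map g xs)
    ≡⟨ cong₂ (λ p q → f x₀ * p + g x₀ * q) (product-cong-off x₀∉ f≡h) (product-cong-off x₀∉ g≡h) ⟩
  f x₀ * product (map h xs) + g x₀ * product (map h xs)
    ≡⟨ ℕ.*-distribʳ-+ (product (map h xs)) (f x₀) (g x₀) ⟨
  (f x₀ + g x₀) * product (map h xs)
    ≡⟨ cong (_* product (map h xs)) at-x₀ ⟩
  h x₀ * product (map h xs) ∎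
  where
  open ≡-Reasoning
  x₀∉ = Unique.Unique[x∷xs]⇒x∉xs u
product-+-at {f = f} {g} {h} {x₀} {x ∷ xs} u@(_ ∷ uxs) (there x₀∈) f≡h g≡h at-x₀ = begin
  f x * product (map f xs) + g x * product (map g xs)
    ≡⟨ cong₂ (λ a b → a * product (map f xs) + b * product (map g xs)) (f≡h x x≢x₀) (g≡h x x≢x₀) ⟩
  h x * product (map f xs) + h x * product (map g xs)
    ≡⟨ ℕ.*-distribˡ-+ (h x) (product (map f xs)) _ ⟨
  h x * (product (map f xs) + product (map g xs))
    ≡⟨ cong (h x *_) (product-+-at uxs x₀∈ f≡h g≡h at-x₀) ⟩
  h x * product (map h xs) ∎
  where
  open ≡-Reasoning
  x≢x₀ : x ≢ x₀
  x≢x₀ refl = Unique.Unique[x∷xs]⇒x∉xs u x₀∈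

sum-allSubsets-suc : ∀ {n} (f : Subset (suc n) → ℕ) →
  sum (map f (allSubsets (suc n)))
    ≡ sum (map (f ∘ (outside ∷_)) (allSubsets n)) + sum (map (f ∘ (inside ∷_)) (allSubsets n))
sum-allSubsets-suc {n} f = begin
  sum (map f (map (outside ∷_) Hs ++ map (inside ∷_) Hs))
    ≡⟨ cong sum (List.map-++ f (map (outside ∷_) Hs) _) ⟩
  sum (map f (map (outside ∷_) Hs) ++ map f (map (inside ∷_) Hs))
    ≡⟨ sum-++ (map f (map (outside ∷_) Hs)) _ ⟩
  sum (map f (map (outside ∷_) Hs)) + sum (map f (map (inside ∷_) Hs))
    ≡⟨ cong₂ (λ xs ys → sum xs + sum ys) (List.map-∘ Hs) (List.map-∘ Hs) ⟨
  sum (map (f ∘ (outside ∷_)) Hs) + sum (map (f ∘ (inside ∷_)) Hs) ∎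
  where
  open ≡-Reasoning
  Hs = allSubsets n

_≤ᴹ_ : ∀ {m} → Mon m → Mon m → Set
β ≤ᴹ α = ∀ J → β J ≤ α J

sumℤ-applyUpTo-zero : ∀ N (g : ℕ → ℕ) (h : ℕ → A) (f : A → ℤ) →
                      (∀ k → k < N → f (h (g k)) ≡ + 0) →
                      sumℤ (map f (map h (applyUpTo g N))) ≡ + 0
sumℤ-applyUpTo-zero zero    g h f f≡0 = refl
sumℤ-applyUpTo-zero (suc N) g h f f≡0 =
  cong₂ _+ℤ_ (f≡0 0 (s≤s z≤n)) (sumℤ-applyUpTo-zero N (g ∘ suc) h f λ k k<N → f≡0 (suc k) (s≤s k<N))

sumℤ-applyUpTo-single : ∀ N (g : ℕ → ℕ) (h : ℕ → A) (f : A → ℤ) k₀ → k₀ < N →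
                        (∀ k → k < N → k ≢ k₀ → f (h (g k)) ≡ + 0) →
                        sumℤ (map f (map h (applyUpTo g N))) ≡ f (h (g k₀))
sumℤ-applyUpTo-single (suc N) g h f zero _ f≡0 =
  trans (cong (f (h (g 0)) +ℤ_)
              (sumℤ-applyUpTo-zero N (g ∘ suc) h f λ k k<N → f≡0 (suc k) (s≤s k<N) λ ()))
        (ℤ.+-identityʳ _)
sumℤ-applyUpTo-single (suc N) g h f (suc k₀) (s≤s k₀<N) f≡0 =
  trans (cong (_+ℤ sumℤ (map f (map h (applyUpTo (g ∘ suc) N)))) (f≡0 0 (s≤s z≤n) λ ()))
        (trans (ℤ.+-identityˡ _)
               (sumℤ-applyUpTo-single N (g ∘ suc) h f k₀ k₀<N
                  λ k k<N k≢k₀ → f≡0 (suc k) (s≤s k<N) (k≢k₀ ∘ ℕ.suc-injective)))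

sum-below-zero : ∀ {m} (α : Mon m) (f : Mon m → ℤ) →
                 (∀ β → β ≤ᴹ α → f β ≡ + 0) → sumℤ (map f (below α)) ≡ + 0
sum-below-zero {zero} α f f≡0 =
  sumℤ-applyUpTo-zero (suc (α [])) (λ k → k) _ f λ k k≤α → f≡0 _ λ { [] → ℕ.≤-pred k≤α }
sum-below-zero {suc m} α f f≡0 =
  trans (sumℤ-concatMap f _ (below (α ∘ (inside ∷_))) (below (α ∘ (outside ∷_))))
        (sum-below-zero (α ∘ (outside ∷_)) _ λ β₀ β₀≤ →
           sum-below-zero (α ∘ (inside ∷_)) _ λ β₁ β₁≤ →
             f≡0 _ λ { (false ∷ J) → β₀≤ J ; (true ∷ J) → β₁≤ J })

-- The term of the sum matching β₀ is found only up to pointwise equality: there is no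
-- function extensionality.
SingleTermSum : ∀ {m} → Mon m → List (Mon m) → Set
SingleTermSum α βs = ∀ f β₀ → β₀ ≤ᴹ α → (∀ β → β ≤ᴹ α → ¬ β ≗ β₀ → f β ≡ + 0) →
                     ∃ λ β → β ≗ β₀ × sumℤ (map f βs) ≡ f β

-- below α merges the two halves of a monomial with an anonymous pattern lambda; abstracting
-- it as merge, with its two computation rules, lets us state the induction step.
merged-single-term : ∀ {m} (merge : Mon m → Mon m → Mon (suc m)) →
  (∀ β₀ β₁ J → merge β₀ β₁ (outside ∷ J) ≡ β₀ J) →
  (∀ β₀ β₁ J → merge β₀ β₁ (inside ∷ J) ≡ β₁ J) →
  (∀ (α : Mon m) → SingleTermSum α (below α)) →
  ∀ (α : Mon (suc m)) → SingleTermSum α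
    (concatMap (λ β₀ → map (merge β₀) (below (α ∘ (inside ∷_)))) (below (α ∘ (outside ∷_))))
merged-single-term {m} merge merge-out merge-in below-single α f δ δ≤α f≡0 =
  merge β₀ β₁ , merged≗δ , trans (sumℤ-concatMap f merge (below αᵢ) (below αₒ)) (trans outer≡ inner≡)
  where
  αₒ αᵢ δₒ δᵢ : Mon m
  αₒ J = α (outside ∷ J)
  αᵢ J = α (inside ∷ J)
  δₒ J = δ (outside ∷ J)
  δᵢ J = δ (inside ∷ J)
  merge-≤ : ∀ {β₀ β₁} → β₀ ≤ᴹ αₒ → β₁ ≤ᴹ αᵢ → merge β₀ β₁ ≤ᴹ α
  merge-≤ {β₀} {β₁} β₀≤ β₁≤ (false ∷ J) = subst (_≤ αₒ J) (sym (merge-out β₀ β₁ J)) (β₀≤ J)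
  merge-≤ {β₀} {β₁} β₀≤ β₁≤ (true ∷ J)  = subst (_≤ αᵢ J) (sym (merge-in β₀ β₁ J)) (β₁≤ J)
  inner-sum : Mon m → ℤ
  inner-sum β₀ = sumℤ (map (f ∘ merge β₀) (below αᵢ))
  outer-single = below-single αₒ inner-sum δₒ (δ≤α ∘ (outside ∷_)) λ β₀ β₀≤ β₀≉ →
    sum-below-zero αᵢ (f ∘ merge β₀) λ β₁ β₁≤ →
      f≡0 (merge β₀ β₁) (merge-≤ β₀≤ β₁≤) λ merged≗ →
        β₀≉ λ J → trans (sym (merge-out β₀ β₁ J)) (merged≗ (outside ∷ J))
  β₀ = proj₁ outer-single
  β₀≗ = proj₁ (proj₂ outer-single)
  outer≡ = proj₂ (proj₂ outer-single)
  β₀≤ : β₀ ≤ᴹ αₒ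
  β₀≤ J = subst (_≤ αₒ J) (sym (β₀≗ J)) (δ≤α (outside ∷ J))
  inner-single = below-single αᵢ (f ∘ merge β₀) δᵢ (δ≤α ∘ (inside ∷_)) λ β₁ β₁≤ β₁≉ →
    f≡0 (merge β₀ β₁) (merge-≤ β₀≤ β₁≤) λ merged≗ →
      β₁≉ λ J → trans (sym (merge-in β₀ β₁ J)) (merged≗ (inside ∷ J))
  β₁ = proj₁ inner-single
  β₁≗ = proj₁ (proj₂ inner-single)
  inner≡ = proj₂ (proj₂ inner-single)
  merged≗δ : merge β₀ β₁ ≗ δ
  merged≗δ (false ∷ J) = trans (merge-out β₀ β₁ J) (β₀≗ J)
  merged≗δ (true ∷ J)  = trans (merge-in β₀ β₁ J) (β₁≗ J)

sum-below-single : ∀ {m} (α : Mon m) → SingleTermSum α (below α)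
sum-below-single {zero} α f β₀ β₀≤α f≡0 =
  _ , (λ { [] → refl }) ,
  sumℤ-applyUpTo-single (suc (α [])) (λ k → k) _ f (β₀ []) (s≤s (β₀≤α []))
    λ k k≤α k≢ → f≡0 _ (λ { [] → ℕ.≤-pred k≤α }) λ k≗ → k≢ (k≗ [])
sum-below-single {suc m} α = merged-single-term _ (λ _ _ _ → refl) (λ _ _ _ → refl) sum-below-single α

0ᴹ : ∀ {m} → Mon m
0ᴹ _ = 0

eᴹ : ∀ {m} → Subset m → Mon m
eᴹ J K = if does (K ≟S J) then 1 else 0

restrict : ∀ {m} → Mon m → Subset m → Mon m
restrict α J K = if does (K ≟S J) then α K else 0

restrict-at : ∀ {m} (α : Mon m) (J : Subset m) → restrict α J J ≡ α J
restrict-at α J rewrite dec-true (J ≟S J) refl = refl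

restrict-off : ∀ {m} (α : Mon m) {J K : Subset m} → K ≢ J → restrict α J K ≡ 0
restrict-off α {J} {K} K≢J rewrite dec-false (K ≟S J) K≢J = refl

_∸ᴹ_ : ∀ {m} → Mon m → Mon m → Mon m
(α ∸ᴹ β) J = α J ∸ β J

eᴹ-at : ∀ {m} (J : Subset m) → eᴹ J J ≡ 1
eᴹ-at J rewrite dec-true (J ≟S J) refl = refl

eᴹ-off : ∀ {m} {J K : Subset m} → K ≢ J → eᴹ J K ≡ 0
eᴹ-off {J = J} {K} K≢J rewrite dec-false (K ≟S J) K≢J = refl

isZeroMon-sound : ∀ {m} (α : Mon m) → isZeroMon α ≡ true → α ≗ 0ᴹ
isZeroMon-sound {zero}  α z [] = ℕ.≡ᵇ⇒≡ (α []) 0 (subst T (sym z) tt)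
isZeroMon-sound {suc m} α z (false ∷ J) =
  isZeroMon-sound (α ∘ (outside ∷_)) (∧-conicalˡ _ _ z) J
isZeroMon-sound {suc m} α z (true ∷ J)  =
  isZeroMon-sound (α ∘ (inside ∷_)) (∧-conicalʳ (isZeroMon (α ∘ (outside ∷_))) _ z) J

isZeroMon-complete : ∀ {m} (α : Mon m) → α ≗ 0ᴹ → isZeroMon α ≡ true
isZeroMon-complete {zero}  α α≗0 rewrite α≗0 [] = refl
isZeroMon-complete {suc m} α α≗0
  rewrite isZeroMon-complete (α ∘ (outside ∷_)) (α≗0 ∘ (outside ∷_))
        | isZeroMon-complete (α ∘ (inside ∷_)) (α≗0 ∘ (inside ∷_)) = refl

isZeroMon-false : ∀ {m} (α : Mon m) → ¬ α ≗ 0ᴹ → isZeroMon α ≡ false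
isZeroMon-false α α≉0 with isZeroMon α in z
... | true  = ⊥-elim (α≉0 (isZeroMon-sound α z))
... | false = refl

oneP-0ᴹ : ∀ {m} {α : Mon m} → α ≗ 0ᴹ → oneP α ≡ + 1
oneP-0ᴹ {α = α} α≗0 rewrite isZeroMon-complete α α≗0 = refl

oneP-≉0ᴹ : ∀ {m} {α : Mon m} → ¬ α ≗ 0ᴹ → oneP α ≡ + 0
oneP-≉0ᴹ {α = α} α≉0 rewrite isZeroMon-false α α≉0 = refl

module _ {m : ℕ} (J : Subset m) where

  private
    lower : Mon m → Mon m
    lower α K = if does (K ≟S J) then α K ∸ 1 else α K

    lower-eᴹ : ∀ {α} → α ≗ eᴹ J → lower α ≗ 0ᴹ
    lower-eᴹ α≗e K with K ≟S J
    ... | yes refl = cong (_∸ 1) (trans (α≗e J) (eᴹ-at J))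
    ... | no  K≢J  = trans (α≗e K) (eᴹ-off K≢J)

    lower-0ᴹ : ∀ {α} → α J ≡ 1 → lower α ≗ 0ᴹ → α ≗ eᴹ J
    lower-0ᴹ αJ≡1 low≗0 K with K ≟S J | low≗0 K
    ... | yes refl | _   = αJ≡1
    ... | no  _    | αK≡0 = αK≡0

  var-eᴹ : ∀ {α} → α ≗ eᴹ J → var J α ≡ + 1
  var-eᴹ {α} α≗e rewrite isZeroMon-complete (lower α) (lower-eᴹ α≗e) | α≗e J | eᴹ-at J = refl

  var-≉eᴹ : ∀ {α} → ¬ α ≗ eᴹ J → var J α ≡ + 0
  var-≉eᴹ {α} α≉e with α J in αJ≡
  ... | zero        = cong (λ b → if b then + 1 else + 0) (∧-zeroʳ (isZeroMon (lower α)))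
  ... | suc (suc _) = cong (λ b → if b then + 1 else + 0) (∧-zeroʳ (isZeroMon (lower α)))
  ... | suc zero    rewrite isZeroMon-false (lower α) (α≉e ∘ lower-0ᴹ αJ≡) = refl

SupportedOn : ∀ {m} → List (Subset m) → Mon m → Set
SupportedOn F α = ∀ K → K ∉ F → α K ≡ 0

supportedOn? : ∀ {m} (F : List (Subset m)) (α : Mon m) → Dec (SupportedOn F α)
supportedOn? F α = allSubset? λ K → ¬? (any? (K ≟S_) F) →-dec (α K ℕ.≟ 0)

SupportedOn-resp-≗ : ∀ {m} {F : List (Subset m)} {α β : Mon m} →
                     α ≗ β → SupportedOn F α → SupportedOn F β
SupportedOn-resp-≗ α≗β supp K K∉F = trans (sym (α≗β K)) (supp K K∉F)

Extensional : ∀ {m} → Poly m → Set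
Extensional p = ∀ {α β} → α ≗ β → p α ≡ p β

-- the series Σₖ a k x_J^k
univariate : ∀ {m} → Subset m → (ℕ → ℤ) → Poly m
univariate J a α = onlyIf (supportedOn? [ J ] α) (a (α J))

univariate-ext : ∀ {m} (J : Subset m) (a : ℕ → ℤ) → Extensional (univariate J a)
univariate-ext J a {α} {β} α≗β =
  onlyIf-cong (supportedOn? [ J ] α) (supportedOn? [ J ] β)
    (does-⇔ (SupportedOn-resp-≗ α≗β) (SupportedOn-resp-≗ (sym ∘ α≗β))
            (supportedOn? [ J ] α) (supportedOn? [ J ] β))
    (cong a (α≗β J))

*P-distribʳ-+P : ∀ {m} (p q r : Poly m) (α : Mon m) → ((p +P q) *P r) α ≡ (p *P r) α +ℤ (q *P r) α
*P-distribʳ-+P p q r α =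
  trans (sumℤ-map-cong (λ β → ℤ.*-distribʳ-+ (r (α ∸ᴹ β)) (p β) (q β)) (below α))
        (sumℤ-map-+ _ _ (below α))

*P-identityˡ : ∀ {m} {q : Poly m} → Extensional q → ∀ α → (oneP *P q) α ≡ q α
*P-identityˡ {q = q} q-ext α
  with sum-below-single α (λ β → oneP β *ℤ q (α ∸ᴹ β)) 0ᴹ (λ _ → z≤n)
         (λ β _ β≉0 → cong (_*ℤ q (α ∸ᴹ β)) (oneP-≉0ᴹ β≉0))
... | β , β≗0 , sum≡ = begin
  (oneP *P q) α            ≡⟨ sum≡ ⟩
  oneP β *ℤ q (α ∸ᴹ β)     ≡⟨ cong₂ _*ℤ_ (oneP-0ᴹ β≗0) (q-ext λ J → cong (α J ∸_) (β≗0 J)) ⟩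
  + 1 *ℤ q α               ≡⟨ ℤ.*-identityˡ (q α) ⟩
  q α                      ∎
  where open ≡-Reasoning

module _ {m : ℕ} (J : Subset m) {q : Poly m} where

  var-*P : Extensional q → ∀ {α} → 1 ≤ α J → (var J *P q) α ≡ q (α ∸ᴹ eᴹ J)
  var-*P q-ext {α} 1≤αJ
    with sum-below-single α (λ β → var J β *ℤ q (α ∸ᴹ β)) (eᴹ J) eᴹ≤α
           (λ β _ β≉e → cong (_*ℤ q (α ∸ᴹ β)) (var-≉eᴹ J β≉e))
    where
    eᴹ≤α : eᴹ J ≤ᴹ α
    eᴹ≤α K with K ≟S J
    ... | yes refl = 1≤αJ
    ... | no  _    = z≤n
  ... | β , β≗e , sum≡ = begin
    (var J *P q) α           ≡⟨ sum≡ ⟩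
    var J β *ℤ q (α ∸ᴹ β)    ≡⟨ cong₂ _*ℤ_ (var-eᴹ J β≗e) (q-ext λ K → cong (α K ∸_) (β≗e K)) ⟩
    + 1 *ℤ q (α ∸ᴹ eᴹ J)     ≡⟨ ℤ.*-identityˡ _ ⟩
    q (α ∸ᴹ eᴹ J)            ∎
    where open ≡-Reasoning

  var-*P-0 : ∀ {α} → α J ≡ 0 → (var J *P q) α ≡ + 0
  var-*P-0 {α} αJ≡0 = sum-below-zero α _ λ β β≤α →
    cong (_*ℤ q (α ∸ᴹ β)) (var-≉eᴹ J λ β≗e →
      ℕ.1+n≰n (subst₂ _≤_ (trans (β≗e J) (eᴹ-at J)) αJ≡0 (β≤α J)))

Extensional-≗ : ∀ {m} {p q : Poly m} → (∀ α → p α ≡ q α) → Extensional q → Extensional p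
Extensional-≗ {p = p} {q} p≡q q-ext {α} {β} α≗β = trans (p≡q α) (trans (q-ext α≗β) (sym (p≡q β)))

module _ {m : ℕ} (J : Subset m) where

  univariate-cong : ∀ (a b : ℕ → ℤ) {α} → a (α J) ≡ b (α J) → univariate J a α ≡ univariate J b α
  univariate-cong a b {α} = cong (onlyIf (supportedOn? [ J ] α))

  univariate-+ : ∀ (a b : ℕ → ℤ) α →
                 univariate J a α +ℤ univariate J b α ≡ univariate J (λ k → a k +ℤ b k) α
  univariate-+ a b α = onlyIf-∙ (supportedOn? [ J ] α) _+ℤ_ refl (a (α J)) (b (α J))

  univariate-∸eᴹ : ∀ (a : ℕ → ℤ) α → univariate J a (α ∸ᴹ eᴹ J) ≡ univariate J (λ k → a (k ∸ 1)) α
  univariate-∸eᴹ a α =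
    onlyIf-cong (supportedOn? [ J ] (α ∸ᴹ eᴹ J)) (supportedOn? [ J ] α)
      (does-⇔ shifted⇒ ⇒shifted (supportedOn? [ J ] (α ∸ᴹ eᴹ J)) (supportedOn? [ J ] α))
      (cong (a ∘ (α J ∸_)) (eᴹ-at J))
    where
    off-J : ∀ {K} → K ∉ [ J ] → (α ∸ᴹ eᴹ J) K ≡ α K
    off-J K∉ = cong (α _ ∸_) (eᴹ-off (K∉ ∘ here))
    shifted⇒ : SupportedOn [ J ] (α ∸ᴹ eᴹ J) → SupportedOn [ J ] α
    shifted⇒ supp K K∉ = trans (sym (off-J K∉)) (supp K K∉)
    ⇒shifted : SupportedOn [ J ] α → SupportedOn [ J ] (α ∸ᴹ eᴹ J)
    ⇒shifted supp K K∉ = trans (off-J K∉) (supp K K∉)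

  oneP-univariate : ∀ α → oneP α ≡ univariate J (λ k → + (0 C k)) α
  oneP-univariate α = by-cases (supportedOn? [ J ] α)
    where
    by-cases : Dec (SupportedOn [ J ] α) → oneP α ≡ univariate J (λ k → + (0 C k)) α
    by-cases (no unsupported) =
      trans (oneP-≉0ᴹ λ α≗0 → unsupported λ K _ → α≗0 K)
            (sym (onlyIf-no (supportedOn? [ J ] α) unsupported))
    by-cases (yes supported) =
      trans (at-J (α J) refl) (sym (onlyIf-yes (supportedOn? [ J ] α) supported))
      where
      at-J : ∀ k → α J ≡ k → oneP α ≡ + (0 C α J)
      at-J zero    αJ≡0 rewrite αJ≡0 = oneP-0ᴹ α≗0
        where
        α≗0 : α ≗ 0ᴹ
        α≗0 K with K ≟S J
        ... | yes refl = αJ≡0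
        ... | no  K≢J  = supported K λ { (here K≡J) → K≢J K≡J }
      at-J (suc k) αJ≡ rewrite αJ≡ = oneP-≉0ᴹ λ α≗0 → ℕ.1+n≢0 (trans (sym αJ≡) (α≗0 J))

  binomial-series : ∀ k α → ((oneP +P var J) ^P k) α ≡ univariate J (λ i → + (k C i)) α
  binomial-series zero    α = oneP-univariate α
  binomial-series (suc k) α = begin
    ((oneP +P var J) *P Pₖ) α
      ≡⟨ *P-distribʳ-+P oneP (var J) Pₖ α ⟩
    (oneP *P Pₖ) α +ℤ (var J *P Pₖ) α
      ≡⟨ cong (_+ℤ (var J *P Pₖ) α) (trans (*P-identityˡ Pₖ-ext α) (binomial-series k α)) ⟩
    univariate J (binom k) α +ℤ (var J *P Pₖ) α
      ≡⟨ pascal (α J) refl ⟩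
    univariate J (binom (suc k)) α ∎
    where
    open ≡-Reasoning
    Pₖ = (oneP +P var J) ^P k
    binom : ℕ → ℕ → ℤ
    binom n i = + (n C i)
    Pₖ-ext : Extensional Pₖ
    Pₖ-ext = Extensional-≗ (binomial-series k) (univariate-ext J (binom k))
    pascal : ∀ i → α J ≡ i → univariate J (binom k) α +ℤ (var J *P Pₖ) α ≡ univariate J (binom (suc k)) α
    pascal zero αJ≡0 = begin
      univariate J (binom k) α +ℤ (var J *P Pₖ) α
        ≡⟨ cong (univariate J (binom k) α +ℤ_) (var-*P-0 J {Pₖ} αJ≡0) ⟩
      univariate J (binom k) α +ℤ + 0
        ≡⟨ ℤ.+-identityʳ _ ⟩
      univariate J (binom k) α
        ≡⟨ univariate-cong (binom k) (binom (suc k))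
                           (subst (λ j → binom k j ≡ binom (suc k) j) (sym αJ≡0) refl) ⟩
      univariate J (binom (suc k)) α ∎
    pascal (suc i) αJ≡ = begin
      univariate J (binom k) α +ℤ (var J *P Pₖ) α
        ≡⟨ cong (univariate J (binom k) α +ℤ_) shifted ⟩
      univariate J (binom k) α +ℤ univariate J (binom k ∘ (_∸ 1)) α
        ≡⟨ univariate-+ (binom k) (binom k ∘ (_∸ 1)) α ⟩
      univariate J (λ j → binom k j +ℤ binom k (j ∸ 1)) α
        ≡⟨ univariate-cong (λ j → binom k j +ℤ binom k (j ∸ 1)) (binom (suc k)) pascal-rule ⟩
      univariate J (binom (suc k)) α ∎
      where
      shifted : (var J *P Pₖ) α ≡ univariate J (binom k ∘ (_∸ 1)) α
      shifted = begin
        (var J *P Pₖ) α                      ≡⟨ var-*P J {Pₖ} Pₖ-ext (subst (1 ≤_) (sym αJ≡) (s≤s z≤n)) ⟩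
        Pₖ (α ∸ᴹ eᴹ J)                       ≡⟨ binomial-series k (α ∸ᴹ eᴹ J) ⟩
        univariate J (binom k) (α ∸ᴹ eᴹ J)   ≡⟨ univariate-∸eᴹ (binom k) α ⟩
        univariate J (binom k ∘ (_∸ 1)) α    ∎
      pascal-rule : binom k (α J) +ℤ binom k (α J ∸ 1) ≡ binom (suc k) (α J)
      pascal-rule rewrite αJ≡ = begin
        + (k C suc i) +ℤ + (k C i)   ≡⟨ ℤ.pos-+ (k C suc i) (k C i) ⟨
        + (k C suc i + k C i)        ≡⟨ cong +_ (ℕ.+-comm (k C suc i) (k C i)) ⟩
        + (k C i + k C suc i)        ≡⟨ cong +_ (nCk+nC[k+1]≡[n+1]C[k+1] k i) ⟩
        + (suc k C suc i)            ∎

  binomial-series-minus-one : ∀ k α →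
    (((oneP +P var J) ^P k) -P oneP) α ≡ univariate J (λ i → + (k C i) -ℤ + (0 C i)) α
  binomial-series-minus-one k α =
    trans (cong₂ _-ℤ_ (binomial-series k α) (oneP-univariate α))
          (onlyIf-∙ (supportedOn? [ J ] α) _-ℤ_ refl (+ (k C α J)) (+ (0 C α J)))


coefficientProduct : ∀ {m} → (Subset m → ℕ → ℤ) → List (Subset m) → Mon m → ℤ
coefficientProduct a F α = productℤ (map (λ J → a J (α J)) F)

coefficientProduct-cong : ∀ {m} (a : Subset m → ℕ → ℤ) {F α α′} → (∀ {K} → K ∈ F → α K ≡ α′ K) →
                          coefficientProduct a F α ≡ coefficientProduct a F α′
coefficientProduct-cong a α≡α′ =
  cong productℤ (List.map-cong-local (All.tabulate λ {K} K∈F → cong (a K) (α≡α′ K∈F)))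

module _ {m : ℕ} (p : Subset m → Poly m) (a : Subset m → ℕ → ℤ)
         (p≡univariate : ∀ J α → p J α ≡ univariate J (a J) α) where

  prodP-univariate : ∀ {F} → Unique F → ∀ α →
                     prodP p F α ≡ onlyIf (supportedOn? F α) (coefficientProduct a F α)
  prodP-univariate {[]} _ α with supportedOn? [] α
  ... | yes supported   = oneP-0ᴹ λ K → supported K λ ()
  ... | no  unsupported = oneP-≉0ᴹ λ α≗0 → unsupported λ K _ → α≗0 K
  prodP-univariate {J ∷ F} u@(J≢F ∷ uF) α
    with sum-below-single α (λ β → p J β *ℤ prodP p F (α ∸ᴹ β)) (restrict α J)
                          restrict-≤ off-restrict-vanishes
    where
    restrict-≤ : restrict α J ≤ᴹ α
    restrict-≤ K with K ≟S J
    ... | yes _ = ℕ.≤-refl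
    ... | no  _ = z≤n
    off-restrict-vanishes : ∀ β → β ≤ᴹ α → ¬ β ≗ restrict α J → p J β *ℤ prodP p F (α ∸ᴹ β) ≡ + 0
    off-restrict-vanishes β β≤α β≉ with supportedOn? [ J ] β
    ... | no ¬onJ =
      cong (_*ℤ prodP p F (α ∸ᴹ β)) (trans (p≡univariate J β) (onlyIf-no (supportedOn? [ J ] β) ¬onJ))
    ... | yes onJ = trans (cong (p J β *ℤ_) (trans (prodP-univariate uF (α ∸ᴹ β))
                                                   (onlyIf-no (supportedOn? F (α ∸ᴹ β)) ¬rest-onF)))
                          (ℤ.*-zeroʳ (p J β))
      where
      ¬rest-onF : ¬ SupportedOn F (α ∸ᴹ β)
      ¬rest-onF rest-onF = β≉ β≗
        where
        β≗ : β ≗ restrict α J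
        β≗ K with K ≟S J
        ... | yes refl = ℕ.≤-antisym (β≤α J) (ℕ.m∸n≡0⇒m≤n (rest-onF J (Unique.Unique[x∷xs]⇒x∉xs u)))
        ... | no  K≢J  = onJ K λ { (here K≡J) → K≢J K≡J }
  ... | β , β≗ , sum≡ = begin
    prodP p (J ∷ F) α
      ≡⟨ sum≡ ⟩
    p J β *ℤ prodP p F (α ∸ᴹ β)
      ≡⟨ cong₂ _*ℤ_ (trans (p≡univariate J β) (onlyIf-yes (supportedOn? [ J ] β) β-onJ))
                    (prodP-univariate uF (α ∸ᴹ β)) ⟩
    a J (β J) *ℤ onlyIf (supportedOn? F (α ∸ᴹ β)) (coefficientProduct a F (α ∸ᴹ β))
      ≡⟨ cong₂ (λ x y → a J x *ℤ onlyIf (supportedOn? F (α ∸ᴹ β)) y) (trans (β≗ J) (restrict-at α J))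
               (coefficientProduct-cong a {F} {α ∸ᴹ β} {α} λ {K} K∈F →
                  rest-off-J {K} λ { refl → All.lookup J≢F K∈F refl }) ⟩
    a J (α J) *ℤ onlyIf (supportedOn? F (α ∸ᴹ β)) (coefficientProduct a F α)
      ≡⟨ onlyIf-*ˡ (supportedOn? F (α ∸ᴹ β)) (supportedOn? (J ∷ F) α)
           (does-⇔ rest-onF⇒onJF onJF⇒rest-onF (supportedOn? F (α ∸ᴹ β)) (supportedOn? (J ∷ F) α))
           (a J (α J)) (coefficientProduct a F α) ⟩
    onlyIf (supportedOn? (J ∷ F) α) (coefficientProduct a (J ∷ F) α) ∎
    where
    open ≡-Reasoning
    β-onJ : SupportedOn [ J ] β
    β-onJ K K∉ = trans (β≗ K) (restrict-off α (K∉ ∘ here))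
    rest-off-J : ∀ {K} → K ≢ J → (α ∸ᴹ β) K ≡ α K
    rest-off-J {K} K≢J = cong (α K ∸_) (trans (β≗ K) (restrict-off α K≢J))
    rest-onF⇒onJF : SupportedOn F (α ∸ᴹ β) → SupportedOn (J ∷ F) α
    rest-onF⇒onJF rest-onF K K∉JF = trans (sym (rest-off-J (K∉JF ∘ here))) (rest-onF K (K∉JF ∘ there))
    onJF⇒rest-onF : SupportedOn (J ∷ F) α → SupportedOn F (α ∸ᴹ β)
    onJF⇒rest-onF onJF K K∉F with K ≟S J
    ... | yes refl = trans (cong (α K ∸_) (trans (β≗ K) (restrict-at α K))) (ℕ.n∸n≡0 (α K))
    ... | no  K≢J  = trans (rest-off-J K≢J) (onJF K λ { (here K≡J) → K≢J K≡J ; (there K∈F) → K∉F K∈F })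

support : ∀ {m} → Mon m → List (Subset m)
support {m} α = filter (λ K → 1 ≤? α K) (allSubsets m)

∈-support⁺ : ∀ {m} (α : Mon m) {J} → 1 ≤ α J → J ∈ support α
∈-support⁺ α {J} = ∈-filter⁺ (λ K → 1 ≤? α K) (∈-allSubsets J)

∈-support⁻ : ∀ {m} (α : Mon m) {J} → J ∈ support α → 1 ≤ α J
∈-support⁻ {m} α = proj₂ ∘ ∈-filter⁻ (λ K → 1 ≤? α K) {xs = allSubsets m}

module _ {m : ℕ} (γ : Subset m → ℕ) where

  factor : Subset m → Poly m
  factor J = ((oneP +P var J) ^P γ J) -P oneP

  factorCoefficient : Subset m → ℕ → ℤ
  factorCoefficient J k = + (γ J C k) -ℤ + (0 C k)

  factor-univariate : ∀ J α → factor J α ≡ univariate J (factorCoefficient J) α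
  factor-univariate J = binomial-series-minus-one J (γ J)

  coefficientProduct-support : ∀ α (xs : List (Subset m)) →
    coefficientProduct factorCoefficient (filter (λ K → 1 ≤? α K) xs) α
      ≡ + product (map (λ J → γ J C α J) xs)
  coefficientProduct-support α [] = refl
  coefficientProduct-support α (J ∷ xs) = by-cases (1 ≤? α J)
    where
    open ≡-Reasoning
    in-support = λ K → 1 ≤? α K
    rest = coefficientProduct-support α xs
    by-cases : Dec (1 ≤ α J) → coefficientProduct factorCoefficient (filter in-support (J ∷ xs)) α
                                 ≡ + product (map (λ J → γ J C α J) (J ∷ xs))
    by-cases (yes 1≤αJ) = begin
      coefficientProduct factorCoefficient (filter in-support (J ∷ xs)) α
        ≡⟨ cong (λ F → coefficientProduct factorCoefficient F α) (List.filter-accept in-support 1≤αJ) ⟩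
      factorCoefficient J (α J) *ℤ coefficientProduct factorCoefficient (filter in-support xs) α
        ≡⟨ cong₂ _*ℤ_ (positive (α J) 1≤αJ) rest ⟩
      + (γ J C α J) *ℤ + product (map (λ J → γ J C α J) xs)
        ≡⟨ ℤ.pos-* (γ J C α J) _ ⟨
      + product (map (λ J → γ J C α J) (J ∷ xs)) ∎
      where
      positive : ∀ k → 1 ≤ k → factorCoefficient J k ≡ + (γ J C k)
      positive (suc k) _ = ℤ.+-identityʳ _
    by-cases (no 1≰αJ) = begin
      coefficientProduct factorCoefficient (filter in-support (J ∷ xs)) α
        ≡⟨ cong (λ F → coefficientProduct factorCoefficient F α) (List.filter-reject in-support 1≰αJ) ⟩
      coefficientProduct factorCoefficient (filter in-support xs) α
        ≡⟨ rest ⟩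
      + product (map (λ J → γ J C α J) xs)
        ≡⟨ cong +_ (ℕ.*-identityˡ _) ⟨
      + ((γ J C 0) * product (map (λ J → γ J C α J) xs))
        ≡⟨ cong (λ k → + ((γ J C k) * product (map (λ J → γ J C α J) xs))) (1≰⇒≡0 1≰αJ) ⟨
      + product (map (λ J → γ J C α J) (J ∷ xs)) ∎

  sumP-prodP-families : ∀ α {Q : List (Subset m) → Set} (Q? : ∀ F → Dec (Q F)) →
    sumP (prodP factor) (filter Q? (sublists (allSubsets m))) α
      ≡ onlyIf (Q? (support α)) (+ product (map (λ J → γ J C α J) (allSubsets m)))
  sumP-prodP-families α Q? = begin
    sumP (prodP factor) (filter Q? (sublists L)) α
      ≡⟨ sumP-apply (prodP factor) (filter Q? (sublists L)) α ⟩
    sumℤ (map (λ F → prodP factor F α) (filter Q? (sublists L)))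
      ≡⟨ sumℤ-filter Q? (λ F → prodP factor F α) (sublists L) ⟩
    sumℤ (map H (sublists L))
      ≡⟨ sumℤ-sublists-filter (λ K → 1 ≤? α K) (allSubsets-unique m) H disagreeing-vanishes ⟩
    onlyIf (Q? (support α)) (prodP factor (support α) α)
      ≡⟨ cong (onlyIf (Q? (support α))) (prodP-factor (Unique.filter⁺ _ (allSubsets-unique m))) ⟩
    onlyIf (Q? (support α))
           (onlyIf (supportedOn? (support α) α) (coefficientProduct factorCoefficient (support α) α))
      ≡⟨ cong (onlyIf (Q? (support α))) (onlyIf-yes (supportedOn? (support α) α) supported) ⟩
    onlyIf (Q? (support α)) (coefficientProduct factorCoefficient (support α) α)
      ≡⟨ cong (onlyIf (Q? (support α))) (coefficientProduct-support α L) ⟩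
    onlyIf (Q? (support α)) (+ product (map (λ J → γ J C α J) L)) ∎
    where
    open ≡-Reasoning
    L = allSubsets m
    H : List (Subset m) → ℤ
    H F = onlyIf (Q? F) (prodP factor F α)
    prodP-factor : ∀ {F} → Unique F →
                   prodP factor F α
                     ≡ onlyIf (supportedOn? F α) (coefficientProduct factorCoefficient F α)
    prodP-factor uF = prodP-univariate factor factorCoefficient factor-univariate uF α
    supported : SupportedOn (support α) α
    supported K K∉ with 1 ≤? α K
    ... | yes 1≤αK = ⊥-elim (K∉ (∈-support⁺ α 1≤αK))
    ... | no  1≰αK = 1≰⇒≡0 1≰αK
    disagreeing-vanishes : ∀ F → F ⊑ L → ∀ K → K ∈ L → Disagrees (λ K → 1 ≤ α K) F K → H F ≡ + 0
    disagreeing-vanishes F F⊑L K _ disagrees =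
      trans (cong (onlyIf (Q? F))
                  (trans (prodP-factor (Unique-resp-⊑ F⊑L (allSubsets-unique m))) (vanishes disagrees)))
            (onlyIf-0 (Q? F))
      where
      vanishes : Disagrees (λ K → 1 ≤ α K) F K →
                 onlyIf (supportedOn? F α) (coefficientProduct factorCoefficient F α) ≡ + 0
      vanishes (inj₁ (K∈F , 1≰αK)) =
        trans (cong (onlyIf (supportedOn? F α))
                    (productℤ-zero (λ J → factorCoefficient J (α J)) K∈F
                                   (cong (factorCoefficient K) (1≰⇒≡0 1≰αK))))
              (onlyIf-0 (supportedOn? F α))
      vanishes (inj₂ (K∉F , 1≤αK)) =
        onlyIf-no (supportedOn? F α) λ onF → ℕ.1+n≰n (subst (1 ≤_) (onF K K∉F) 1≤αK)

-- Cliques.Γ c J is classOf V (Cliques.memb c) J by definition; keeping W and cls general lets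
-- signatures be counted by induction on the vertices.
classOf : ∀ {n m} → Subset n → (Fin n → Subset m) → Subset m → Subset n
classOf W cls J = Vec.tabulate λ v → does (v ∈ˢ? W) ∧ does (cls v ≟S J)

HasSignature : ∀ {n m} → Subset n → (Fin n → Subset m) → Mon m → Subset n → Set
HasSignature W cls α H = H ⊆ W × (∀ J → ∣ H ∩ classOf W cls J ∣ ≡ α J)

hasSignature? : ∀ {n m} W (cls : Fin n → Subset m) α H → Dec (HasSignature W cls α H)
hasSignature? W cls α H = H ⊆? W ×-dec allSubset? λ J → ∣ H ∩ classOf W cls J ∣ ℕ.≟ α J

binomialProduct : ∀ {n m} → Subset n → (Fin n → Subset m) → Mon m → ℕ
binomialProduct {m = m} W cls α = product (map (λ J → ∣ classOf W cls J ∣ C α J) (allSubsets m))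

signatureCount : ∀ {n m} → Subset n → (Fin n → Subset m) → Mon m → ℕ
signatureCount {n} W cls α = sum (map (𝟙 ∘ hasSignature? W cls α) (allSubsets n))

module _ {n m : ℕ} (W : Subset n) (cls : Fin (suc n) → Subset m) where

  private
    cls′ : Fin n → Subset m
    cls′ = cls ∘ fsuc
    K₀ = cls fzero

  signature-outside : ∀ w α H →
                      𝟙 (hasSignature? (w ∷ W) cls α (outside ∷ H)) ≡ 𝟙 (hasSignature? W cls′ α H)
  signature-outside w α H =
    𝟙-⇔ drop unDrop (hasSignature? (w ∷ W) cls α (outside ∷ H)) (hasSignature? W cls′ α H)
    where
    drop : HasSignature (w ∷ W) cls α (outside ∷ H) → HasSignature W cls′ α H
    drop (H⊆ , sig≡) = drop-∷-⊆ H⊆ , sig≡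
    unDrop : HasSignature W cls′ α H → HasSignature (w ∷ W) cls α (outside ∷ H)
    unDrop (H⊆ , sig≡) = out⊆ H⊆ , sig≡

  signature-inside-outside : ∀ α H → 𝟙 (hasSignature? (outside ∷ W) cls α (inside ∷ H)) ≡ 0
  signature-inside-outside α H =
    𝟙-no (hasSignature? (outside ∷ W) cls α (inside ∷ H)) λ (H⊆ , _) → case H⊆ here of λ ()

  signature-inside-inside : ∀ α H → 𝟙 (hasSignature? (inside ∷ W) cls α (inside ∷ H))
                                   ≡ 𝟙 (1 ≤? α K₀) * 𝟙 (hasSignature? W cls′ (α ∸ᴹ eᴹ K₀) H)
  signature-inside-inside α H =
    trans (𝟙-⇔ split unsplit (hasSignature? (inside ∷ W) cls α (inside ∷ H)) (1 ≤? α K₀ ×-dec rest?))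
          (𝟙-× (1 ≤? α K₀) rest?)
    where
    rest? = hasSignature? W cls′ (α ∸ᴹ eᴹ K₀) H
    count-at : ∣ (inside ∷ H) ∩ classOf (inside ∷ W) cls K₀ ∣ ≡ suc ∣ H ∩ classOf W cls′ K₀ ∣
    count-at rewrite dec-true (K₀ ≟S K₀) refl = refl
    count-off : ∀ {J} → J ≢ K₀ → ∣ (inside ∷ H) ∩ classOf (inside ∷ W) cls J ∣ ≡ ∣ H ∩ classOf W cls′ J ∣
    count-off {J} J≢K₀ rewrite dec-false (K₀ ≟S J) (J≢K₀ ∘ sym) = refl
    split : HasSignature (inside ∷ W) cls α (inside ∷ H) → 1 ≤ α K₀ × HasSignature W cls′ (α ∸ᴹ eᴹ K₀) H
    split (H⊆ , sig≡) = subst (1 ≤_) (trans (sym count-at) (sig≡ K₀)) (s≤s z≤n) , drop-∷-⊆ H⊆ , sig′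
      where
      sig′ : ∀ J → ∣ H ∩ classOf W cls′ J ∣ ≡ (α ∸ᴹ eᴹ K₀) J
      sig′ J with J ≟S K₀
      ... | yes refl = cong (_∸ 1) (trans (sym count-at) (sig≡ K₀))
      ... | no  J≢K₀ = trans (sym (count-off J≢K₀)) (sig≡ J)
    unsplit : 1 ≤ α K₀ × HasSignature W cls′ (α ∸ᴹ eᴹ K₀) H →
              HasSignature (inside ∷ W) cls α (inside ∷ H)
    unsplit (1≤αK₀ , H⊆ , sig≡) = in⊆in H⊆ , sig′
      where
      sig′ : ∀ J → ∣ (inside ∷ H) ∩ classOf (inside ∷ W) cls J ∣ ≡ α J
      sig′ J with J ≟S K₀ | sig≡ J
      ... | yes refl | sigK₀ = trans count-at (trans (cong suc sigK₀) (ℕ.m+[n∸m]≡n 1≤αK₀))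
      ... | no  J≢K₀ | sigJ  = trans (count-off J≢K₀) sigJ

  classSize-at : ∣ classOf (inside ∷ W) cls K₀ ∣ ≡ suc ∣ classOf W cls′ K₀ ∣
  classSize-at rewrite dec-true (K₀ ≟S K₀) refl = refl

  classSize-off : ∀ {J} → J ≢ K₀ → ∣ classOf (inside ∷ W) cls J ∣ ≡ ∣ classOf W cls′ J ∣
  classSize-off {J} J≢K₀ rewrite dec-false (K₀ ≟S J) (J≢K₀ ∘ sym) = refl

  binomialProduct-inside : ∀ α →
    binomialProduct W cls′ α + 𝟙 (1 ≤? α K₀) * binomialProduct W cls′ (α ∸ᴹ eᴹ K₀)
      ≡ binomialProduct (inside ∷ W) cls α
  binomialProduct-inside α = by-cases (1 ≤? α K₀)
    where
    γ′ : Subset m → ℕ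
    γ′ J = ∣ classOf W cls′ J ∣
    by-cases : (d : Dec (1 ≤ α K₀)) →
               binomialProduct W cls′ α + 𝟙 d * binomialProduct W cls′ (α ∸ᴹ eᴹ K₀)
                 ≡ binomialProduct (inside ∷ W) cls α
    by-cases (no 1≰αK₀) =
      trans (ℕ.+-identityʳ _) (cong product (List.map-cong same-factor (allSubsets m)))
      where
      same-factor : ∀ J → γ′ J C α J ≡ ∣ classOf (inside ∷ W) cls J ∣ C α J
      same-factor J with J ≟S K₀
      ... | yes refl rewrite 1≰⇒≡0 1≰αK₀ = refl
      ... | no  J≢K₀ = cong (_C α J) (sym (classSize-off J≢K₀))
    by-cases (yes 1≤αK₀) =
      trans (cong (_+_ (binomialProduct W cls′ α)) (ℕ.*-identityˡ _))
            (product-+-at (allSubsets-unique m) (∈-allSubsets K₀)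
               (λ J J≢K₀ → cong (_C α J) (sym (classSize-off J≢K₀)))
               (λ J J≢K₀ → cong₂ _C_ (sym (classSize-off J≢K₀)) (cong (α J ∸_) (eᴹ-off J≢K₀)))
               at-K₀)
      where
      pascal : ∀ k → 1 ≤ k → γ′ K₀ C k + γ′ K₀ C (k ∸ 1) ≡ suc (γ′ K₀) C k
      pascal (suc k) _ = trans (ℕ.+-comm (γ′ K₀ C suc k) _) (nCk+nC[k+1]≡[n+1]C[k+1] (γ′ K₀) k)
      at-K₀ : γ′ K₀ C α K₀ + γ′ K₀ C (α K₀ ∸ eᴹ K₀ K₀) ≡ ∣ classOf (inside ∷ W) cls K₀ ∣ C α K₀
      at-K₀ rewrite eᴹ-at K₀ | classSize-at = pascal (α K₀) 1≤αK₀

signatureCount-≡ : ∀ {n m} (W : Subset n) (cls : Fin n → Subset m) (α : Mon m) →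
                 signatureCount W cls α ≡ binomialProduct W cls α
signatureCount-≡ {zero} {m} [] cls α = by-cases (hasSignature? [] cls α [])
  where
  by-cases : (d : Dec (HasSignature [] cls α [])) → 𝟙 d + 0 ≡ binomialProduct [] cls α
  by-cases (yes (_ , sig≡)) = sym (product-map-1 (λ J → cong (0 C_) (sym (sig≡ J))) (allSubsets m))
  by-cases (no ¬sig) with product-0C α (allSubsets m)
  ... | inj₁ product≡0 = sym product≡0
  ... | inj₂ α≡0       = ⊥-elim (¬sig ((λ ()) , λ J → sym (α≡0 (∈-allSubsets J))))
signatureCount-≡ {suc n} {m} (outside ∷ W) cls α = begin
  signatureCount (outside ∷ W) cls α
    ≡⟨ sum-allSubsets-suc (𝟙 ∘ hasSignature? (outside ∷ W) cls α) ⟩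
  sum (map (𝟙 ∘ hasSignature? (outside ∷ W) cls α ∘ (outside ∷_)) Hs)
    + sum (map (𝟙 ∘ hasSignature? (outside ∷ W) cls α ∘ (inside ∷_)) Hs)
    ≡⟨ cong₂ _+_ (cong sum (List.map-cong (signature-outside W cls outside α) Hs))
                 (sum-map-0 (signature-inside-outside W cls α) Hs) ⟩
  signatureCount W (cls ∘ fsuc) α + 0
    ≡⟨ ℕ.+-identityʳ _ ⟩
  signatureCount W (cls ∘ fsuc) α
    ≡⟨ signatureCount-≡ W (cls ∘ fsuc) α ⟩
  binomialProduct (outside ∷ W) cls α ∎
  where
  open ≡-Reasoning
  Hs = allSubsets n
signatureCount-≡ {suc n} {m} (inside ∷ W) cls α = begin
  signatureCount (inside ∷ W) cls α
    ≡⟨ sum-allSubsets-suc (𝟙 ∘ hasSignature? (inside ∷ W) cls α) ⟩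
  sum (map (𝟙 ∘ hasSignature? (inside ∷ W) cls α ∘ (outside ∷_)) Hs)
    + sum (map (𝟙 ∘ hasSignature? (inside ∷ W) cls α ∘ (inside ∷_)) Hs)
    ≡⟨ cong₂ _+_ (cong sum (List.map-cong (signature-outside W cls inside α) Hs))
                 (trans (cong sum (List.map-cong (signature-inside-inside W cls α) Hs))
                        (sum-map-*ˡ (𝟙 (1 ≤? α K₀)) _ Hs)) ⟩
  signatureCount W cls′ α + 𝟙 (1 ≤? α K₀) * signatureCount W cls′ (α ∸ᴹ eᴹ K₀)
    ≡⟨ cong₂ (λ a b → a + 𝟙 (1 ≤? α K₀) * b)
             (signatureCount-≡ W cls′ α) (signatureCount-≡ W cls′ (α ∸ᴹ eᴹ K₀)) ⟩
  binomialProduct W cls′ α + 𝟙 (1 ≤? α K₀) * binomialProduct W cls′ (α ∸ᴹ eᴹ K₀)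
    ≡⟨ binomialProduct-inside W cls α ⟩
  binomialProduct (inside ∷ W) cls α ∎
  where
  open ≡-Reasoning
  Hs = allSubsets n
  cls′ = cls ∘ fsuc
  K₀ = cls fzero

∈-tabulate⁻ : ∀ {n} {f : Fin n → Bool} {x} → x ∈ˢ Vec.tabulate f → f x ≡ true
∈-tabulate⁻ {f = f} {x} x∈ = trans (sym (Vec.lookup∘tabulate f x)) (Vec.[]=⇒lookup x∈)

∈-tabulate⁺ : ∀ {n} {f : Fin n → Bool} {x} → f x ≡ true → x ∈ˢ Vec.tabulate f
∈-tabulate⁺ {f = f} {x} fx≡ = Vec.lookup⇒[]= x _ (trans (Vec.lookup∘tabulate f x) fx≡)

∈⋃-tabulate⁻ : ∀ {m n} (c : Fin m → Subset n) {v} → v ∈ˢ ⋃ (tabulate c) → ∃ λ j → v ∈ˢ c j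
∈⋃-tabulate⁻ {zero}  c v∈ = ⊥-elim (∉⊥ v∈)
∈⋃-tabulate⁻ {suc m} c v∈ with x∈p∪q⁻ (c fzero) (⋃ (tabulate (c ∘ fsuc))) v∈
... | inj₁ v∈c₀   = fzero , v∈c₀
... | inj₂ v∈rest = Data.Product.map fsuc id (∈⋃-tabulate⁻ (c ∘ fsuc) v∈rest)

∈⇒1≤∣_∣ : ∀ {n} (p : Subset n) {x} → x ∈ˢ p → 1 ≤ ∣ p ∣
∈⇒1≤∣ inside ∷ p ∣ here       = s≤s z≤n
∈⇒1≤∣ b ∷ p ∣      (there x∈) = ℕ.≤-trans (∈⇒1≤∣ p ∣ x∈) (∣p∣≤∣x∷p∣ b p)

1≤∣_∣⇒Nonempty : ∀ {n} (p : Subset n) → 1 ≤ ∣ p ∣ → Nonempty p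
1≤∣ inside ∷ p ∣⇒Nonempty _ = fzero , here
1≤∣ outside ∷ p ∣⇒Nonempty 1≤ = Data.Product.map fsuc there (1≤∣ p ∣⇒Nonempty 1≤)

module _ {n m : ℕ} (c : Fin m → Subset n) where
  open Cliques c

  ∈memb⁻ : ∀ {v j} → j ∈ˢ memb v → v ∈ˢ c j
  ∈memb⁻ {v} {j} j∈ = does-true⁻ (v ∈ˢ? c j) (∈-tabulate⁻ j∈)

  ∈memb⁺ : ∀ {v j} → v ∈ˢ c j → j ∈ˢ memb v
  ∈memb⁺ {v} {j} v∈ = ∈-tabulate⁺ (dec-true (v ∈ˢ? c j) v∈)

  ∈Γ⁻ : ∀ {v J} → v ∈ˢ Γ J → memb v ≡ J
  ∈Γ⁻ {v} {J} v∈ = does-true⁻ (memb v ≟S J) (∧-conicalʳ _ _ (∈-tabulate⁻ v∈))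

  ∈Γ-memb : ∀ {v} → v ∈ˢ V → v ∈ˢ Γ (memb v)
  ∈Γ-memb {v} v∈V = ∈-tabulate⁺ (cong₂ _∧_ (dec-true (v ∈ˢ? V) v∈V) (dec-true (memb v ≟S memb v) refl))

  memb-self-intersecting : ∀ {v} → v ∈ˢ V → Nonempty (memb v ∩ memb v)
  memb-self-intersecting v∈V with ∈⋃-tabulate⁻ c v∈V
  ... | j , v∈cj = j , x∈p∩q⁺ (∈memb⁺ v∈cj , ∈memb⁺ v∈cj)

  module _ (α : Mon m) {H : Subset n} (H⊆V : H ⊆ V) (sig≡α : ∀ J → sig H J ≡ α J) where

    memb-∈-support : ∀ {v} → v ∈ˢ H → memb v ∈ support α
    memb-∈-support {v} v∈H =
      ∈-support⁺ α (subst (1 ≤_) (sig≡α (memb v))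
                          (∈⇒1≤∣ H ∩ Γ (memb v) ∣ (x∈p∩q⁺ (v∈H , ∈Γ-memb (H⊆V v∈H)))))

    vertex-of-class : ∀ {J} → J ∈ support α → ∃ λ v → v ∈ˢ H × memb v ≡ J
    vertex-of-class {J} J∈ with 1≤∣ H ∩ Γ J ∣⇒Nonempty (subst (1 ≤_) (sym (sig≡α J)) (∈-support⁻ α J∈))
    ... | v , v∈H∩Γ = v , proj₁ (x∈p∩q⁻ H (Γ J) v∈H∩Γ) , ∈Γ⁻ (proj₂ (x∈p∩q⁻ H (Γ J) v∈H∩Γ))

    nonempty⇒ : Nonempty H → NonemptyFam (support α)
    nonempty⇒ (v , v∈H) T≡[] = case subst (memb v ∈_) T≡[] (memb-∈-support v∈H) of λ ()

    nonempty⇐ : NonemptyFam (support α) → Nonempty H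
    nonempty⇐ T≢[] with support α in T≡ | T≢[]
    ... | []    | T≢[] = ⊥-elim (T≢[] refl)
    ... | J ∷ _ | _    = let v , v∈H , _ = vertex-of-class (subst (J ∈_) (sym T≡) (here refl)) in v , v∈H

    clique⇒intersecting : IsCliqueU H → Intersecting (support α)
    clique⇒intersecting clique = All.tabulate λ A∈ → All.tabulate λ B∈ → meet A∈ B∈
      where
      meet : ∀ {A B} → A ∈ support α → B ∈ support α → Nonempty (A ∩ B)
      meet A∈ B∈ with vertex-of-class A∈ | vertex-of-class B∈
      ... | u , u∈H , refl | v , v∈H , refl with u ≟ᶠ v
      ...   | yes refl = memb-self-intersecting (H⊆V u∈H)
      ...   | no  u≢v  = let j , u∈cj , v∈cj = clique u v u∈H v∈H u≢v
                         in j , x∈p∩q⁺ (∈memb⁺ u∈cj , ∈memb⁺ v∈cj)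

    intersecting⇒clique : Intersecting (support α) → IsCliqueU H
    intersecting⇒clique intersecting u v u∈H v∈H _
      with All.lookup (All.lookup intersecting (memb-∈-support u∈H)) (memb-∈-support v∈H)
    ... | j , j∈ = let j∈u , j∈v = x∈p∩q⁻ (memb u) (memb v) j∈ in j , ∈memb⁻ j∈u , ∈memb⁻ j∈v

module _ {n m : ℕ} (c : Fin m → Subset n) (α : Mon m) where
  open Cliques c

  counted-indicator : ∀ H → 𝟙 (Counted? α H)
                            ≡ 𝟙 (NonemptyIntersecting? (support α)) * 𝟙 (hasSignature? V memb α H)
  counted-indicator H =
    trans (𝟙-⇔ split unsplit (Counted? α H) (NI? ×-dec hasSignature? V memb α H))
          (𝟙-× NI? (hasSignature? V memb α H))
    where
    NI? = NonemptyIntersecting? (support α)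
    split : Counted α H → (NonemptyFam (support α) × Intersecting (support α)) × HasSignature V memb α H
    split (nonempty , H⊆V , clique , sig≡α) =
      (nonempty⇒ c α H⊆V sig≡α nonempty , clique⇒intersecting c α H⊆V sig≡α clique) , H⊆V , sig≡α
    unsplit : (NonemptyFam (support α) × Intersecting (support α)) × HasSignature V memb α H →
              Counted α H
    unsplit ((nonempty , intersecting) , H⊆V , sig≡α) =
      nonempty⇐ c α H⊆V sig≡α nonempty , H⊆V , intersecting⇒clique c α H⊆V sig≡α intersecting , sig≡α

  cliqueCount-≡ : cliqueCount α ≡ 𝟙 (NonemptyIntersecting? (support α)) * binomialProduct V memb α
  cliqueCount-≡ = begin
    length (filter (Counted? α) Hs)
      ≡⟨ length-filter (Counted? α) Hs ⟩
    sum (map (𝟙 ∘ Counted? α) Hs)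
      ≡⟨ cong sum (List.map-cong counted-indicator Hs) ⟩
    sum (map (λ H → 𝟙 NI? * 𝟙 (hasSignature? V memb α H)) Hs)
      ≡⟨ sum-map-*ˡ (𝟙 NI?) (𝟙 ∘ hasSignature? V memb α) Hs ⟩
    𝟙 NI? * signatureCount V memb α
      ≡⟨ cong (𝟙 NI? *_) (signatureCount-≡ V memb α) ⟩
    𝟙 NI? * binomialProduct V memb α ∎
    where
    open ≡-Reasoning
    Hs = allSubsets n
    NI? = NonemptyIntersecting? (support α)

theorem5p3 : (n m : ℕ) (c : Fin m → Subset n) (α : Mon m) →
    coeff (Cliques.Φ c) α ≡ + Cliques.cliqueCount c α
theorem5p3 n m c α = begin
  coeff Φ α
    ≡⟨ sumP-prodP-families γ α NonemptyIntersecting? ⟩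
  onlyIf NI? (+ binomialProduct V memb α)
    ≡⟨ onlyIf-pos NI? (binomialProduct V memb α) ⟩
  + (𝟙 NI? * binomialProduct V memb α)
    ≡⟨ cong +_ (cliqueCount-≡ c α) ⟨
  + cliqueCount α ∎
  where
  open Cliques c
  open ≡-Reasoning
  NI? = NonemptyIntersecting? (support α)
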